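{- Let $r<s\le N/2$ be positive integers with $\gcd(r,s,N)=1$. Let $\widetilde Q$ be the infinite quiver defined below and let $\Lambda=\{(A,B)\in\mathbb{Z}^2: Ar+Bs\equiv 0 \pmod N\}$ act on it by translations (these preserve labels). Identifying vertices of $\widetilde Q$ with the same label (i.e. folding $\widetilde Q$ onto the torus $\mathbb{R}^2/\Lambda$), the resulting quiver on vertices $1,\dots,N$ agrees exactly with the quiver $\overline{Q_N^{(r,s)}}$ (possibly containing 2-cycles).
   Context: For $(A,B)\in\mathbb{Z}^2$ let $\lambda(A,B)\in\{1,\dots,N\}$ be the residue of $1+Ar+Bs$ mod $N$. $\widetilde Q$ has vertex set $\mathbb{Z}^2$, vertex $(A,B)$ labeled $\lambda(A,B)$, an arrow between $(A,B)$ and $(A+1,B)$ oriented from the smaller label to the larger, an arrow between $(A,B)$ and $(A,B+1)$ oriented from the larger label to the smaller, and in each unit square whose lower-left, upper-left, upper-right, lower-right corners have labels $i,i+s,i+r+s,i+r$ (mod $N$, $i\in\{1,\dots,N\}$): a diagonal arrow from the corner labeled $i+r$ to the corner labeled $i+s$ if $i+r+s\le N$, a diagonal arrow from the corner labeled $i+r+s-N$ to the corner labeled $i$ if $i+r\le N<i+s$, and no diagonal otherwise. $\overline{Q_N^{(r,s)}}$ is the quiver on vertices $1,\dots,N$ with: (1) arrows $i\to i+r$ for $1\le i\le N-r$ and $j\to N-r+j$ for $1\le j\le r$; (2) arrows $s+i\to i$ for $1\le i\le N-s$ and $N-s+j\to j$ for $1\le j\le s$; (3) arrows $r+i\to s+i$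 for $1\le i\le N-r-s$ and $r+j\to N-s+j$ for $1\le j\le s-r$ (2-cycles are not removed). -}

module Defs where

open import Data.Nat as ℕ using (ℕ; suc; _+_; _∸_; _≤_; _<_; NonZero; _<ᵇ_)
open import Data.Integer as ℤ using (ℤ; +_; _%ℕ_)
open import Data.Integer.Divisibility using (_∣_)
open import Data.Product using (_×_; _,_; Σ)
open import Data.Sum using (_⊎_)
open import Data.Bool using (if_then_else_)
open import Relation.Binary.PropositionalEquality using (_≡_)

Vtx : Set
Vtx = ℤ × ℤ

lab : (N r s : ℕ) .{{_ : NonZero N}} → Vtx → ℕ
lab N r s (A , B) = suc ((A ℤ.* + r ℤ.+ B ℤ.* + s) %ℕ N)

-- The diagonal in the unit square with lower-left corner (A,B), where
-- i = λ(A,B) is the lower-left label.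
-- Case 1 (i+r+s ≤ N): arrow from the corner labelled i+r (lower-right)
--                     to the corner labelled i+s (upper-left).
-- Case 2 (i+r ≤ N < i+s): arrow from the corner labelled i+r+s-N
--                     (upper-right) to the corner labelled i (lower-left).
DiagCase1 DiagCase2 : (N r s : ℕ) .{{_ : NonZero N}} → Vtx → Set
DiagCase1 N r s v = lab N r s v + r + s ≤ N
DiagCase2 N r s v = (lab N r s v + r ≤ N) × (N < lab N r s v + s)

-- Arrows of Q̃, indexed by their position (the lower-left point).
data TArr (N r s : ℕ) .{{_ : NonZero N}} : Set where
  hor   : (A B : ℤ) → TArr N r s
  ver   : (A B : ℤ) → TArr N r s
  diag₁ : (A B : ℤ) → DiagCase1 N r s (A , B) → TArr N r s
  diag₂ : (A B : ℤ) → DiagCase2 N r s (A , B) → TArr N r s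

module _ {N r s : ℕ} .{{_ : NonZero N}} where

  private
    λ' = lab N r s
    suc' = ℤ._+_ (+ 1)

  tailT headT : TArr N r s → Vtx
  tailT (hor A B) = if λ' (A , B) <ᵇ λ' (suc' A , B) then (A , B) else (suc' A , B)
  tailT (ver A B) = if λ' (A , B) <ᵇ λ' (A , suc' B) then (A , suc' B) else (A , B)
  tailT (diag₁ A B _) = (suc' A , B)
  tailT (diag₂ A B _) = (suc' A , suc' B)
  headT (hor A B) = if λ' (A , B) <ᵇ λ' (suc' A , B) then (suc' A , B) else (A , B)
  headT (ver A B) = if λ' (A , B) <ᵇ λ' (A , suc' B) then (A , B) else (A , suc' B)
  headT (diag₁ A B _) = (A , suc' B)
  headT (diag₂ A B _) = (A , B)

InΛ : (N r s : ℕ) → Vtx → Set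
InΛ N r s (a , b) = + N ∣ (a ℤ.* + r ℤ.+ b ℤ.* + s)

data SameOrbit (N r s : ℕ) .{{_ : NonZero N}} : TArr N r s → TArr N r s → Set where
  hor   : ∀ A B a b → InΛ N r s (a , b) →
          SameOrbit N r s (hor A B) (hor (A ℤ.+ a) (B ℤ.+ b))
  ver   : ∀ A B a b → InΛ N r s (a , b) →
          SameOrbit N r s (ver A B) (ver (A ℤ.+ a) (B ℤ.+ b))
  diag₁ : ∀ A B a b p q → InΛ N r s (a , b) →
          SameOrbit N r s (diag₁ A B p) (diag₁ (A ℤ.+ a) (B ℤ.+ b) q)
  diag₂ : ∀ A B a b p q → InΛ N r s (a , b) →
          SameOrbit N r s (diag₂ A B p) (diag₂ (A ℤ.+ a) (B ℤ.+ b) q)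

data QArr (N r s : ℕ) : Set where
  a1  : (i : ℕ) → 1 ≤ i → i ≤ N ∸ r → QArr N r s
  a1' : (j : ℕ) → 1 ≤ j → j ≤ r → QArr N r s
  a2  : (i : ℕ) → 1 ≤ i → i ≤ N ∸ s → QArr N r s
  a2' : (j : ℕ) → 1 ≤ j → j ≤ s → QArr N r s
  a3  : (i : ℕ) → 1 ≤ i → i ≤ N ∸ r ∸ s → QArr N r s
  a3' : (j : ℕ) → 1 ≤ j → j ≤ s ∸ r → QArr N r s

module _ {N r s : ℕ} where
  tailQ headQ : QArr N r s → ℕ
  tailQ (a1 i _ _) = i
  tailQ (a1' j _ _) = j
  tailQ (a2 i _ _) = s + i
  tailQ (a2' j _ _) = N ∸ s + j
  tailQ (a3 i _ _) = r + i
  tailQ (a3' j _ _) = r + j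
  headQ (a1 i _ _) = i + r
  headQ (a1' j _ _) = N ∸ r + j
  headQ (a2 i _ _) = i
  headQ (a2' j _ _) = j
  headQ (a3 i _ _) = s + i
  headQ (a3' j _ _) = N ∸ s + j

-- An arrow of Q̃ is determined by its kind (horizontal, vertical, or one of the
-- two diagonals) and the lower-left corner v of its unit square, and the labels
-- of its endpoints are the label i = λ(v) shifted by 0, r, s or r + s modulo N.
-- Folding sends it to the arrow of \overline{Q_N^{(r,s)}} of the same kind
-- attached to i, and the endpoint labels agree case by case, the two cases of a
-- horizontal (vertical) arrow being whether i + r (i + s) exceeds N. Conversely
-- an arrow of the folded quiver is determined by its kind and that corner label,
-- so two arrows of Q̃ have the same image iff they have the same kind and corners
-- with equal labels, i.e. corners differing by a vector of Λ. Every label occurs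
-- because gcd(r,s,N) = 1 gives U r + V s ≡ 1 (mod N) by Bézout, so that the
-- vertex (kU, kV) has label k + 1.
module Submission where

open import Defs
open import Data.Nat using (ℕ; _*_; _≤_; _<_; NonZero)
open import Data.Nat.GCD using (gcd)
open import Data.Product using (_×_; Σ; ∃)
open import Function.Bundles using (_⇔_)
open import Relation.Binary.PropositionalEquality using (_≡_)

open import Data.Bool using (true; false; if_then_else_)
open import Data.Integer as ℤ using (ℤ; +_; -_; _%ℕ_; _/ℕ_; ∣_∣)
open import Data.Integer.DivMod using (n%ℕd<d; a≡a%ℕn+[a/ℕn]*n)
open import Data.Integer.Divisibility.Signed
  using (_∣_; divides; ∣⇒∣ᵤ; ∣ᵤ⇒∣; ∣-refl; ∣m∣n⇒∣m+n; ∣m⇒∣-m; ∣n⇒∣m*n)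
import Data.Integer.Properties as ℤ
open import Data.Integer.Tactic.RingSolver using (solve-∀)
open import Data.Nat using (suc; _+_; _∸_; _<ᵇ_; _≤?_; z≤n; s≤s; s≤s⁻¹)
open import Data.Nat.DivMod using (m<n⇒m%n≡m)
open import Data.Nat.Divisibility using (n∣m⇒m%n≡0)
open import Data.Nat.GCD using (gcd-GCD; module Bézout)
open import Data.Nat.Properties
open import Algebra.Properties.CommutativeSemigroup +-commutativeSemigroup using (x∙yz≈y∙xz)
open import Data.Product using (_,_; ∃₂; uncurry)
open import Function.Bundles using (mk⇔; module Equivalence)
open import Relation.Nullary using (Dec; Irrelevant; yes; no; contradiction)
open import Relation.Binary.PropositionalEquality
  using (refl; sym; trans; cong; cong₂; subst; subst₂; module ≡-Reasoning)

if-<ᵇ : ∀ {A : Set} {m n} {x y : A} → m < n → (if m <ᵇ n then x else y) ≡ x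
if-<ᵇ {m = m} {n} m<n with m <ᵇ n | <⇒<ᵇ m<n
... | true | _ = refl

if-≮ᵇ : ∀ {A : Set} {m n} {x y : A} → n ≤ m → (if m <ᵇ n then x else y) ≡ y
if-≮ᵇ {m = m} {n} n≤m with m <ᵇ n | <ᵇ⇒< m n
... | false | _ = refl
... | true | m<n = contradiction (m<n _) (≤⇒≯ n≤m)

×-irrelevant : ∀ {A B : Set} → Irrelevant A → Irrelevant B → Irrelevant (A × B)
×-irrelevant irrA irrB (a , b) (a′ , b′) = cong₂ _,_ (irrA a a′) (irrB b b′)

cong-bounded : ∀ {A : Set} {l u} (c : (j : ℕ) → l ≤ j → j ≤ u → A) {j j′ p q p′ q′} →
               j ≡ j′ → c j p q ≡ c j′ p′ q′
cong-bounded c refl = cong₂ (c _) (≤-irrelevant _ _) (≤-irrelevant _ _)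

m∸n+o+n≡m+o : ∀ {m n} o → n ≤ m → m ∸ n + o + n ≡ m + o
m∸n+o+n≡m+o {m} {n} o n≤m = begin
  m ∸ n + o + n ≡⟨ cong (_+ n) (+-∸-comm o n≤m) ⟨
  m + o ∸ n + n ≡⟨ m∸n+n≡m (≤-trans n≤m (m≤m+n m o)) ⟩
  m + o         ∎
  where open ≡-Reasoning

m∸n+[o+n∸m]≡o : ∀ {m n} o → n ≤ m → m ≤ o + n → m ∸ n + (o + n ∸ m) ≡ o
m∸n+[o+n∸m]≡o {m} {n} o n≤m m≤o+n = +-cancelʳ-≡ n _ _ (begin
  m ∸ n + (o + n ∸ m) + n ≡⟨ m∸n+o+n≡m+o (o + n ∸ m) n≤m ⟩
  m + (o + n ∸ m)         ≡⟨ m+[n∸m]≡n m≤o+n ⟩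
  o + n                   ∎)
  where open ≡-Reasoning

m≤n⇒m+o∸n≤o : ∀ {m n} o → m ≤ n → m + o ∸ n ≤ o
m≤n⇒m+o∸n≤o {m} {n} o m≤n = m≤n+o⇒m∸n≤o (m + o) n (+-monoˡ-≤ o m≤n)

m<m∸n+o+n : ∀ {m n o} → n ≤ m → 0 < o → m < m ∸ n + o + n
m<m∸n+o+n {m} {n} {o} n≤m 0<o = subst (m <_) (sym (m∸n+o+n≡m+o o n≤m)) (m<m+n m 0<o)

m∸n+o+n∸m≡o : ∀ {m n} o → n ≤ m → m ∸ n + o + n ∸ m ≡ o
m∸n+o+n∸m≡o {m} o n≤m = trans (cong (_∸ m) (m∸n+o+n≡m+o o n≤m)) (m+n∸m≡n m o)

m∸n+o≤m : ∀ {m n o} → n ≤ m → o ≤ n → m ∸ n + o ≤ m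
m∸n+o≤m {m} {n} n≤m o≤n = ≤-trans (+-monoʳ-≤ (m ∸ n) o≤n) (≤-reflexive (m∸n+n≡m n≤m))

m+n+o≤p⇒m≤p∸n∸o : ∀ m {n o p} → m + n + o ≤ p → m ≤ p ∸ n ∸ o
m+n+o≤p⇒m≤p∸n∸o m {n} {o} {p} m+n+o≤p =
  subst (m ≤_) (sym (∸-+-assoc p n o)) (m+n≤o⇒m≤o∸n m (subst (_≤ p) (+-assoc m n o) m+n+o≤p))

m≤p∸n∸o⇒m+n+o≤p : ∀ m {n o p} → n + o ≤ p → m ≤ p ∸ n ∸ o → m + n + o ≤ p
m≤p∸n∸o⇒m+n+o≤p m {n} {o} {p} n+o≤p m≤p∸n∸o =
  subst (_≤ p) (sym (+-assoc m n o)) (m≤o∸n⇒m+n≤o m n+o≤p (subst (m ≤_) (∸-+-assoc p n o) m≤p∸n∸o))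

m+n∸o≤m : ∀ m {n o} → n ≤ o → m + n ∸ o ≤ m
m+n∸o≤m m {n} n≤o = ≤-trans (∸-monoʳ-≤ (m + n) n≤o) (≤-reflexive (m+n∸n≡m m n))

m+n≤o⇒m+p∸o≤p∸n : ∀ {m n o} p → m + n ≤ o → m + p ∸ o ≤ p ∸ n
m+n≤o⇒m+p∸o≤p∸n {m} {n} p m+n≤o = ≤-trans (∸-monoʳ-≤ (m + p) m+n≤o) (≤-reflexive ([m+n]∸[m+o]≡n∸o m p n))

-- A record rather than an abbreviation of + n ∣ x ℤ.- y, so that x and y can be inferred.
infix 4 _≡_mod_
record _≡_mod_ (x y : ℤ) (n : ℕ) : Set where
  constructor congruent
  field divides-difference : + n ∣ x ℤ.- y

module _ {n : ℕ} where

  ≡-mod-sym : ∀ {x y} → x ≡ y mod n → y ≡ x mod n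
  ≡-mod-sym {x} {y} (congruent n∣x-y) = congruent (subst (+ n ∣_) (-[x-y]≡y-x x y) (∣m⇒∣-m n∣x-y))
    where
    -[x-y]≡y-x : ∀ x y → - (x ℤ.- y) ≡ y ℤ.- x
    -[x-y]≡y-x = solve-∀

  ≡-mod-trans : ∀ {x y z} → x ≡ y mod n → y ≡ z mod n → x ≡ z mod n
  ≡-mod-trans {x} {y} {z} (congruent p) (congruent q) =
    congruent (subst (+ n ∣_) (ℤ.+-minus-telescope x y z) (∣m∣n⇒∣m+n p q))

  +-congʳ-mod : ∀ t {x y} → x ≡ y mod n → x ℤ.+ t ≡ y ℤ.+ t mod n
  +-congʳ-mod t {x} {y} (congruent p) = congruent (subst (+ n ∣_) (sym ([x+t]-[y+t]≡x-y x y t)) p)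
    where
    [x+t]-[y+t]≡x-y : ∀ x y t → (x ℤ.+ t) ℤ.- (y ℤ.+ t) ≡ x ℤ.- y
    [x+t]-[y+t]≡x-y = solve-∀

  *-congˡ-mod : ∀ c {x y} → x ≡ y mod n → c ℤ.* x ≡ c ℤ.* y mod n
  *-congˡ-mod c {x} {y} (congruent p) = congruent (subst (+ n ∣_) (c*[x-y]≡cx-cy c x y) (∣n⇒∣m*n c p))
    where
    c*[x-y]≡cx-cy : ∀ c x y → c ℤ.* (x ℤ.- y) ≡ c ℤ.* x ℤ.- c ℤ.* y
    c*[x-y]≡cx-cy = solve-∀

  ≡-mod-minus-n : ∀ x → x ≡ x ℤ.- + n mod n
  ≡-mod-minus-n x = congruent (subst (+ n ∣_) (sym (x-[x-m]≡m x (+ n))) ∣-refl)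
    where
    x-[x-m]≡m : ∀ x m → x ℤ.- (x ℤ.- m) ≡ m
    x-[x-m]≡m = solve-∀

module _ (n : ℕ) .{{_ : NonZero n}} where

  ≡-mod-%ℕ : ∀ x → x ≡ + (x %ℕ n) mod n
  ≡-mod-%ℕ x = congruent (divides (x /ℕ n) (begin
    x ℤ.- + (x %ℕ n)                                 ≡⟨ cong (ℤ._- + (x %ℕ n)) (a≡a%ℕn+[a/ℕn]*n x n) ⟩
    + (x %ℕ n) ℤ.+ (x /ℕ n) ℤ.* + n ℤ.- + (x %ℕ n)   ≡⟨ [m+y]-m≡y (+ (x %ℕ n)) ((x /ℕ n) ℤ.* + n) ⟩
    (x /ℕ n) ℤ.* + n                                 ∎))
    where
    open ≡-Reasoning
    [m+y]-m≡y : ∀ m y → m ℤ.+ y ℤ.- m ≡ y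
    [m+y]-m≡y = solve-∀

  ≡-mod-<⇒≡ : ∀ {i j} → i < n → j < n → + i ≡ + j mod n → i ≡ j
  ≡-mod-<⇒≡ {i} {j} i<n j<n (congruent n∣i-j) =
    ℤ.+-injective (ℤ.i-j≡0⇒i≡j (+ i) (+ j) (ℤ.∣i∣≡0⇒i≡0 ∣i-j∣≡0))
    where
    ∣i-j∣<n : ∣ + i ℤ.- + j ∣ < n
    ∣i-j∣<n = subst (_< n) (cong ∣_∣ (sym (ℤ.m-n≡m⊖n i j)))
                (≤-<-trans (ℤ.∣m⊝n∣≤m⊔n i j) (⊔-pres-<m i<n j<n))
    ∣i-j∣≡0 : ∣ + i ℤ.- + j ∣ ≡ 0
    ∣i-j∣≡0 = trans (sym (m<n⇒m%n≡m ∣i-j∣<n)) (n∣m⇒m%n≡0 _ n (∣⇒∣ᵤ n∣i-j))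

  %ℕ-unique : ∀ x {k} → k < n → x ≡ + k mod n → x %ℕ n ≡ k
  %ℕ-unique x k<n x≡k = ≡-mod-<⇒≡ (n%ℕd<d x n) k<n (≡-mod-trans (≡-mod-sym (≡-mod-%ℕ x)) x≡k)

  %ℕ-≡⇔≡-mod : ∀ x y → x %ℕ n ≡ y %ℕ n ⇔ (x ≡ y mod n)
  %ℕ-≡⇔≡-mod x y = mk⇔
    (λ eq → ≡-mod-trans (≡-mod-%ℕ x)
              (subst (λ k → + k ≡ y mod n) (sym eq) (≡-mod-sym (≡-mod-%ℕ y))))
    (λ x≡y → %ℕ-unique x (n%ℕd<d y n) (≡-mod-trans x≡y (≡-mod-%ℕ y)))

  ≡-mod-%ℕ-+ : ∀ x t → x ℤ.+ + t ≡ + (x %ℕ n + t) mod n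
  ≡-mod-%ℕ-+ x t = subst (λ z → x ℤ.+ + t ≡ z mod n) (sym (ℤ.pos-+ (x %ℕ n) t))
                      (+-congʳ-mod (+ t) (≡-mod-%ℕ x))

  +-%ℕ-< : ∀ x t → x %ℕ n + t < n → (x ℤ.+ + t) %ℕ n ≡ x %ℕ n + t
  +-%ℕ-< x t no-wrap = %ℕ-unique (x ℤ.+ + t) no-wrap (≡-mod-%ℕ-+ x t)

  +-%ℕ-≥ : ∀ x t → t ≤ n → n ≤ x %ℕ n + t → (x ℤ.+ + t) %ℕ n ≡ x %ℕ n + t ∸ n
  +-%ℕ-≥ x t t≤n wrap = %ℕ-unique (x ℤ.+ + t) m+t∸n<n
    (≡-mod-trans (≡-mod-%ℕ-+ x t)
      (subst (λ z → + (m + t) ≡ z mod n) m+t-n≡m+t∸n (≡-mod-minus-n (+ (m + t)))))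
    where
    m : ℕ
    m = x %ℕ n
    m+t∸n<n : m + t ∸ n < n
    m+t∸n<n = ≤-<-trans (∸-monoʳ-≤ (m + t) t≤n) (subst (_< n) (sym (m+n∸n≡m m t)) (n%ℕd<d x n))
    m+t-n≡m+t∸n : + (m + t) ℤ.- + n ≡ + (m + t ∸ n)
    m+t-n≡m+t∸n = trans (ℤ.m-n≡m⊖n (m + t) n) (ℤ.⊖-≥ wrap)

ℕ-Bézout⇒ℤ : ∀ {d} x y a b → d + y * b ≡ x * a → + d ≡ + x ℤ.* + a ℤ.+ - + y ℤ.* + b
ℕ-Bézout⇒ℤ {d} x y a b eq = begin
  + d                                 ≡⟨ [d+z]-z≡d (+ d) (+ y ℤ.* + b) ⟨
  + d ℤ.+ + y ℤ.* + b ℤ.- + y ℤ.* + b ≡⟨ cong (ℤ._- + y ℤ.* + b) lifted ⟩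
  + x ℤ.* + a ℤ.- + y ℤ.* + b         ≡⟨ cong (ℤ._+_ (+ x ℤ.* + a)) (ℤ.neg-distribˡ-* (+ y) (+ b)) ⟩
  + x ℤ.* + a ℤ.+ - + y ℤ.* + b       ∎
  where
  open ≡-Reasoning
  [d+z]-z≡d : ∀ d z → d ℤ.+ z ℤ.- z ≡ d
  [d+z]-z≡d = solve-∀
  lifted : + d ℤ.+ + y ℤ.* + b ≡ + x ℤ.* + a
  lifted = begin
    + d ℤ.+ + y ℤ.* + b ≡⟨ cong (ℤ._+_ (+ d)) (ℤ.pos-* y b) ⟨
    + d ℤ.+ + (y * b)   ≡⟨ ℤ.pos-+ d (y * b) ⟨
    + (d + y * b)       ≡⟨ cong +_ eq ⟩
    + (x * a)           ≡⟨ ℤ.pos-* x a ⟩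
    + x ℤ.* + a         ∎

Bézoutℤ : ∀ a b → ∃₂ λ u v → + gcd a b ≡ u ℤ.* + a ℤ.+ v ℤ.* + b
Bézoutℤ a b with Bézout.identity (gcd-GCD a b)
... | Bézout.+- x y eq = + x , - + y , ℕ-Bézout⇒ℤ x y a b eq
... | Bézout.-+ x y eq =
  - + x , + y , trans (ℕ-Bézout⇒ℤ y x b a eq) (ℤ.+-comm (+ y ℤ.* + b) (- + x ℤ.* + a))

gcd₃≡1⇒Bézout-mod : ∀ {a b n} → gcd (gcd a b) n ≡ 1 → ∃₂ λ u v → u ℤ.* + a ℤ.+ v ℤ.* + b ≡ + 1 mod n
gcd₃≡1⇒Bézout-mod {a} {b} {n} gcd≡1 with Bézoutℤ (gcd a b) n | Bézoutℤ a b
... | α , β , e₁ | γ , δ , e₂ = α ℤ.* γ , α ℤ.* δ , congruent (divides (- β) (begin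
  α ℤ.* γ ℤ.* + a ℤ.+ α ℤ.* δ ℤ.* + b ℤ.- + 1      ≡⟨ regroup α γ δ (+ a) (+ b) (+ 1) ⟩
  α ℤ.* (γ ℤ.* + a ℤ.+ δ ℤ.* + b) ℤ.- + 1          ≡⟨ cong₂ (λ g e → α ℤ.* g ℤ.- e) (sym e₂) 1≡αg+βn ⟩
  α ℤ.* + gcd a b ℤ.- (α ℤ.* + gcd a b ℤ.+ β ℤ.* + n) ≡⟨ cancel (α ℤ.* + gcd a b) β (+ n) ⟩
  - β ℤ.* + n                                      ∎))
  where
  open ≡-Reasoning
  1≡αg+βn : + 1 ≡ α ℤ.* + gcd a b ℤ.+ β ℤ.* + n
  1≡αg+βn = trans (cong +_ (sym gcd≡1)) e₁
  regroup : ∀ α γ δ a b e → α ℤ.* γ ℤ.* a ℤ.+ α ℤ.* δ ℤ.* b ℤ.- e ≡ α ℤ.* (γ ℤ.* a ℤ.+ δ ℤ.* b) ℤ.- e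
  regroup = solve-∀
  cancel : ∀ x β n → x ℤ.- (x ℤ.+ β ℤ.* n) ≡ - β ℤ.* n
  cancel = solve-∀

infixl 6 _+ᵥ_ _−ᵥ_
_+ᵥ_ _−ᵥ_ : Vtx → Vtx → Vtx
(A , B) +ᵥ (a , b) = A ℤ.+ a , B ℤ.+ b
(A , B) −ᵥ (a , b) = A ℤ.- a , B ℤ.- b

[v+ᵥδ]−ᵥv≡δ : ∀ v δ → v +ᵥ δ −ᵥ v ≡ δ
[v+ᵥδ]−ᵥv≡δ (A , B) (a , b) = cong₂ _,_ ([x+y]-x≡y A a) ([x+y]-x≡y B b)
  where
  [x+y]-x≡y : ∀ x y → x ℤ.+ y ℤ.- x ≡ y
  [x+y]-x≡y = solve-∀

v+ᵥ[w−ᵥv]≡w : ∀ v w → v +ᵥ (w −ᵥ v) ≡ w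
v+ᵥ[w−ᵥv]≡w (A , B) (A′ , B′) = cong₂ _,_ (x+[y-x]≡y A A′) (x+[y-x]≡y B B′)
  where
  x+[y-x]≡y : ∀ x y → x ℤ.+ (y ℤ.- x) ≡ y
  x+[y-x]≡y = solve-∀

data Kind : Set where
  hor ver diag₁ diag₂ : Kind

module Folding (N r s : ℕ) .{{_ : NonZero N}} (0<r : 0 < r) (r<s : r < s) (r+s≤N : r + s ≤ N) where

  r≤N : r ≤ N
  r≤N = m+n≤o⇒m≤o r r+s≤N

  s≤N : s ≤ N
  s≤N = m+n≤o⇒n≤o r r+s≤N

  val : Vtx → ℤ
  val (A , B) = A ℤ.* + r ℤ.+ B ℤ.* + s

  label : Vtx → ℕ
  label = lab N r s

  val-−ᵥ : ∀ v w → val (v −ᵥ w) ≡ val v ℤ.- val w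
  val-−ᵥ (A , B) (A′ , B′) = linear A B A′ B′ (+ r) (+ s)
    where
    linear : ∀ A B A′ B′ R S →
             (A ℤ.- A′) ℤ.* R ℤ.+ (B ℤ.- B′) ℤ.* S ≡ A ℤ.* R ℤ.+ B ℤ.* S ℤ.- (A′ ℤ.* R ℤ.+ B′ ℤ.* S)
    linear = solve-∀

  val-right : ∀ A B → val (+ 1 ℤ.+ A , B) ≡ val (A , B) ℤ.+ + r
  val-right A B = shift A B (+ r) (+ s)
    where
    shift : ∀ A B R S → (+ 1 ℤ.+ A) ℤ.* R ℤ.+ B ℤ.* S ≡ A ℤ.* R ℤ.+ B ℤ.* S ℤ.+ R
    shift = solve-∀

  val-up : ∀ A B → val (A , + 1 ℤ.+ B) ≡ val (A , B) ℤ.+ + s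
  val-up A B = shift A B (+ r) (+ s)
    where
    shift : ∀ A B R S → A ℤ.* R ℤ.+ (+ 1 ℤ.+ B) ℤ.* S ≡ A ℤ.* R ℤ.+ B ℤ.* S ℤ.+ S
    shift = solve-∀

  val-diagonal : ∀ A B → val (+ 1 ℤ.+ A , + 1 ℤ.+ B) ≡ val (A , B) ℤ.+ + (r + s)
  val-diagonal A B = trans (shift A B (+ r) (+ s)) (cong (ℤ._+_ (val (A , B))) (sym (ℤ.pos-+ r s)))
    where
    shift : ∀ A B R S → (+ 1 ℤ.+ A) ℤ.* R ℤ.+ (+ 1 ℤ.+ B) ℤ.* S ≡ A ℤ.* R ℤ.+ B ℤ.* S ℤ.+ (R ℤ.+ S)
    shift = solve-∀

  label-+-≤ : ∀ v w {t} → val w ≡ val v ℤ.+ + t → label v + t ≤ N → label w ≡ label v + t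
  label-+-≤ v w {t} e no-wrap = cong suc (trans (cong (_%ℕ N) e) (+-%ℕ-< N (val v) t no-wrap))

  label-+-> : ∀ v w {t} → val w ≡ val v ℤ.+ + t → t ≤ N → N < label v + t → label w ≡ label v + t ∸ N
  label-+-> v w {t} e t≤N wrap =
    trans (cong suc (trans (cong (_%ℕ N) e) (+-%ℕ-≥ N (val v) t t≤N (s≤s⁻¹ wrap))))
          (sym (+-∸-assoc 1 (s≤s⁻¹ wrap)))

  label-≡⇔InΛ : ∀ v w → label v ≡ label w ⇔ InΛ N r s (v −ᵥ w)
  label-≡⇔InΛ v w = mk⇔
    (λ eq → ∣⇒∣ᵤ (subst (+ N ∣_) (sym (val-−ᵥ v w)) (_≡_mod_.divides-difference (to (suc-injective eq)))))
    (λ l → cong suc (from (congruent (subst (+ N ∣_) (val-−ᵥ v w) (∣ᵤ⇒∣ l)))))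
    where open Equivalence (%ℕ-≡⇔≡-mod N (val v) (val w))

  label-+ᵥ-InΛ : ∀ v δ → InΛ N r s δ → label v ≡ label (v +ᵥ δ)
  label-+ᵥ-InΛ v δ l =
    sym (Equivalence.from (label-≡⇔InΛ (v +ᵥ δ) v) (subst (InΛ N r s) (sym ([v+ᵥδ]−ᵥv≡δ v δ)) l))

  label-surjective : (∃₂ λ U V → U ℤ.* + r ℤ.+ V ℤ.* + s ≡ + 1 mod N) →
                     ∀ {i} → 1 ≤ i × i ≤ N → ∃ λ v → label v ≡ i
  label-surjective (U , V , UV≡1) {suc k} (_ , k<N) =
    (+ k ℤ.* U , + k ℤ.* V) , cong suc (%ℕ-unique N _ k<N val≡k)
    where
    regroup : ∀ k U V R S → k ℤ.* U ℤ.* R ℤ.+ k ℤ.* V ℤ.* S ≡ k ℤ.* (U ℤ.* R ℤ.+ V ℤ.* S)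
    regroup = solve-∀
    val≡k : val (+ k ℤ.* U , + k ℤ.* V) ≡ + k mod N
    val≡k = subst₂ (λ a b → a ≡ b mod N) (sym (regroup (+ k) U V (+ r) (+ s))) (ℤ.*-identityʳ (+ k))
              (*-congˡ-mod (+ k) UV≡1)

  kindT : TArr N r s → Kind
  kindT (hor _ _) = hor
  kindT (ver _ _) = ver
  kindT (diag₁ _ _ _) = diag₁
  kindT (diag₂ _ _ _) = diag₂

  corner : TArr N r s → Vtx
  corner (hor A B) = A , B
  corner (ver A B) = A , B
  corner (diag₁ A B _) = A , B
  corner (diag₂ A B _) = A , B

  kindQ : QArr N r s → Kind
  kindQ (a1 _ _ _) = hor
  kindQ (a1' _ _ _) = hor
  kindQ (a2 _ _ _) = ver
  kindQ (a2' _ _ _) = ver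
  kindQ (a3 _ _ _) = diag₁
  kindQ (a3' _ _ _) = diag₂

  -- The label of the lower-left corner of the squares of Q̃ whose arrows fold onto the given one.
  cornerLabel : QArr N r s → ℕ
  cornerLabel (a1 i _ _) = i
  cornerLabel (a1' j _ _) = N ∸ r + j
  cornerLabel (a2 i _ _) = i
  cornerLabel (a2' j _ _) = N ∸ s + j
  cornerLabel (a3 i _ _) = i
  cornerLabel (a3' j _ _) = N ∸ s + j

  -- A square of Q̃ with lower-left label i carries an arrow of kind k
  -- (for the diagonals these are DiagCase1 and DiagCase2).
  Admissible : Kind → ℕ → Set
  Admissible hor i = 1 ≤ i × i ≤ N
  Admissible ver i = 1 ≤ i × i ≤ N
  Admissible diag₁ i = 1 ≤ i × i + r + s ≤ N
  Admissible diag₂ i = i + r ≤ N × N < i + s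

  Admissible-irrelevant : ∀ k {i} → Irrelevant (Admissible k i)
  Admissible-irrelevant hor = ×-irrelevant ≤-irrelevant ≤-irrelevant
  Admissible-irrelevant ver = ×-irrelevant ≤-irrelevant ≤-irrelevant
  Admissible-irrelevant diag₁ = ×-irrelevant ≤-irrelevant ≤-irrelevant
  Admissible-irrelevant diag₂ = ×-irrelevant ≤-irrelevant ≤-irrelevant

  Admissible⇒1≤i≤N : ∀ k {i} → Admissible k i → 1 ≤ i × i ≤ N
  Admissible⇒1≤i≤N hor a = a
  Admissible⇒1≤i≤N ver a = a
  Admissible⇒1≤i≤N diag₁ {i} (1≤i , i+r+s≤N) = 1≤i , m+n≤o⇒m≤o i (m+n≤o⇒m≤o (i + r) i+r+s≤N)
  Admissible⇒1≤i≤N diag₂ {i} (i+r≤N , N<i+s) = +-cancelʳ-< s 0 i (≤-<-trans s≤N N<i+s) , m+n≤o⇒m≤o i i+r≤N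

  -- c covers the arrows i → i + t (or i + t → i), c′ those wrapping around past N.
  cyclicArrow : ∀ t → ((i : ℕ) → 1 ≤ i → i ≤ N ∸ t → QArr N r s) → ((j : ℕ) → 1 ≤ j → j ≤ t → QArr N r s) →
                (i : ℕ) → 1 ≤ i × i ≤ N → QArr N r s
  cyclicArrow t c c′ i (1≤i , i≤N) with i + t ≤? N
  ... | yes i+t≤N = c i 1≤i (m+n≤o⇒m≤o∸n i i+t≤N)
  ... | no i+t≰N = c′ (i + t ∸ N) (m<n⇒0<n∸m (≰⇒> i+t≰N)) (m≤n⇒m+o∸n≤o t i≤N)

  cyclicArrow-≤ : ∀ {t} c c′ {i} a {p q} → i + t ≤ N → cyclicArrow t c c′ i a ≡ c i p q
  cyclicArrow-≤ {t} c c′ {i} a i+t≤N with i + t ≤? N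
  ... | yes _ = cong-bounded c refl
  ... | no i+t≰N = contradiction i+t≤N i+t≰N

  cyclicArrow-> : ∀ {t} c c′ {i j} a {p q} → N < i + t → i + t ∸ N ≡ j → cyclicArrow t c c′ i a ≡ c′ j p q
  cyclicArrow-> {t} c c′ {i} a N<i+t e with i + t ≤? N
  ... | yes i+t≤N = contradiction i+t≤N (<⇒≱ N<i+t)
  ... | no _ = cong-bounded c′ e

  arrow : ∀ k i → Admissible k i → QArr N r s
  arrow hor = cyclicArrow r a1 a1'
  arrow ver = cyclicArrow s a2 a2'
  arrow diag₁ i (1≤i , i+r+s≤N) = a3 i 1≤i (m+n+o≤p⇒m≤p∸n∸o i i+r+s≤N)
  arrow diag₂ i (i+r≤N , N<i+s) = a3' (i + s ∸ N) (m<n⇒0<n∸m N<i+s) (m+n≤o⇒m+p∸o≤p∸n s i+r≤N)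

  arrow-cong : ∀ k {i i′} (a : Admissible k i) (a′ : Admissible k i′) → i ≡ i′ → arrow k i a ≡ arrow k i′ a′
  arrow-cong k a a′ refl = cong (arrow k _) (Admissible-irrelevant k a a′)

  kindQ-arrow : ∀ k i a → kindQ (arrow k i a) ≡ k
  kindQ-arrow hor i a with i + r ≤? N
  ... | yes _ = refl
  ... | no _ = refl
  kindQ-arrow ver i a with i + s ≤? N
  ... | yes _ = refl
  ... | no _ = refl
  kindQ-arrow diag₁ i a = refl
  kindQ-arrow diag₂ i a = refl

  cornerLabel-arrow : ∀ k i a → cornerLabel (arrow k i a) ≡ i
  cornerLabel-arrow hor i a with i + r ≤? N
  ... | yes _ = refl
  ... | no i+r≰N = m∸n+[o+n∸m]≡o i r≤N (<⇒≤ (≰⇒> i+r≰N))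
  cornerLabel-arrow ver i a with i + s ≤? N
  ... | yes _ = refl
  ... | no i+s≰N = m∸n+[o+n∸m]≡o i s≤N (<⇒≤ (≰⇒> i+s≰N))
  cornerLabel-arrow diag₁ i a = refl
  cornerLabel-arrow diag₂ i (_ , N<i+s) = m∸n+[o+n∸m]≡o i s≤N (<⇒≤ N<i+s)

  admissibleQ : ∀ y → Admissible (kindQ y) (cornerLabel y)
  admissibleQ (a1 i 1≤i i≤N∸r) = 1≤i , ≤-trans i≤N∸r (m∸n≤m N r)
  admissibleQ (a1' j 1≤j j≤r) = ≤-trans 1≤j (m≤n+m j (N ∸ r)) , m∸n+o≤m r≤N j≤r
  admissibleQ (a2 i 1≤i i≤N∸s) = 1≤i , ≤-trans i≤N∸s (m∸n≤m N s)
  admissibleQ (a2' j 1≤j j≤s) = ≤-trans 1≤j (m≤n+m j (N ∸ s)) , m∸n+o≤m s≤N j≤s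
  admissibleQ (a3 i 1≤i i≤N∸r∸s) = 1≤i , m≤p∸n∸o⇒m+n+o≤p i r+s≤N i≤N∸r∸s
  admissibleQ (a3' j 1≤j j≤s∸r) =
      subst (_≤ N) (sym (+-assoc (N ∸ s) j r)) (m∸n+o≤m s≤N (m≤o∸n⇒m+n≤o j (<⇒≤ r<s) j≤s∸r))
    , m<m∸n+o+n s≤N 1≤j

  arrow-cornerLabel : ∀ y → arrow (kindQ y) (cornerLabel y) (admissibleQ y) ≡ y
  arrow-cornerLabel (a1 i _ i≤N∸r) = cyclicArrow-≤ a1 a1' _ (m≤o∸n⇒m+n≤o i r≤N i≤N∸r)
  arrow-cornerLabel (a1' j 1≤j _) = cyclicArrow-> a1 a1' _ (m<m∸n+o+n r≤N 1≤j) (m∸n+o+n∸m≡o j r≤N)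
  arrow-cornerLabel (a2 i _ i≤N∸s) = cyclicArrow-≤ a2 a2' _ (m≤o∸n⇒m+n≤o i s≤N i≤N∸s)
  arrow-cornerLabel (a2' j 1≤j _) = cyclicArrow-> a2 a2' _ (m<m∸n+o+n s≤N 1≤j) (m∸n+o+n∸m≡o j s≤N)
  arrow-cornerLabel (a3 i _ _) = cong-bounded a3 refl
  arrow-cornerLabel (a3' j _ _) = cong-bounded a3' (m∸n+o+n∸m≡o j s≤N)

  admissibleT : ∀ x → Admissible (kindT x) (label (corner x))
  admissibleT (hor A B) = s≤s z≤n , n%ℕd<d (val (A , B)) N
  admissibleT (ver A B) = s≤s z≤n , n%ℕd<d (val (A , B)) N
  admissibleT (diag₁ A B p) = s≤s z≤n , p
  admissibleT (diag₂ A B p) = p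

  fold : TArr N r s → QArr N r s
  fold x = arrow (kindT x) (label (corner x)) (admissibleT x)

  EndpointsAgree : TArr N r s → Set
  EndpointsAgree x = tailQ (fold x) ≡ label (tailT x) × headQ (fold x) ≡ label (headT x)

  hor-endpoints : ∀ A B → Dec (label (A , B) + r ≤ N) → EndpointsAgree (hor A B)
  hor-endpoints A B (yes no-wrap) =
      trans (cong tailQ folded) (sym (cong label (if-<ᵇ ascending)))
    , trans (cong headQ folded) (trans (sym right≡) (sym (cong label (if-<ᵇ ascending))))
    where
    folded : fold (hor A B) ≡ a1 (label (A , B)) (s≤s z≤n) (m+n≤o⇒m≤o∸n _ no-wrap)
    folded = cyclicArrow-≤ a1 a1' (admissibleT (hor A B)) no-wrap
    right≡ : label (+ 1 ℤ.+ A , B) ≡ label (A , B) + r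
    right≡ = label-+-≤ (A , B) (+ 1 ℤ.+ A , B) (val-right A B) no-wrap
    ascending : label (A , B) < label (+ 1 ℤ.+ A , B)
    ascending = subst (label (A , B) <_) (sym right≡) (m<m+n _ 0<r)
  hor-endpoints A B (no wraps) =
      trans (cong tailQ folded) (trans (sym right≡) (sym (cong label (if-≮ᵇ descending))))
    , trans (cong headQ folded)
            (trans (m∸n+[o+n∸m]≡o i r≤N (<⇒≤ N<i+r)) (sym (cong label (if-≮ᵇ descending))))
    where
    i : ℕ
    i = label (A , B)
    N<i+r : N < i + r
    N<i+r = ≰⇒> wraps
    folded : fold (hor A B) ≡ a1' (i + r ∸ N) (m<n⇒0<n∸m N<i+r) (m≤n⇒m+o∸n≤o r (n%ℕd<d (val (A , B)) N))
    folded = cyclicArrow-> a1 a1' (admissibleT (hor A B)) N<i+r refl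
    right≡ : label (+ 1 ℤ.+ A , B) ≡ i + r ∸ N
    right≡ = label-+-> (A , B) (+ 1 ℤ.+ A , B) (val-right A B) r≤N N<i+r
    descending : label (+ 1 ℤ.+ A , B) ≤ i
    descending = subst (_≤ i) (sym right≡) (m+n∸o≤m i r≤N)

  ver-endpoints : ∀ A B → Dec (label (A , B) + s ≤ N) → EndpointsAgree (ver A B)
  ver-endpoints A B (yes no-wrap) =
      trans (cong tailQ folded) (trans (+-comm s _) (trans (sym up≡) (sym (cong label (if-<ᵇ ascending)))))
    , trans (cong headQ folded) (sym (cong label (if-<ᵇ ascending)))
    where
    folded : fold (ver A B) ≡ a2 (label (A , B)) (s≤s z≤n) (m+n≤o⇒m≤o∸n _ no-wrap)
    folded = cyclicArrow-≤ a2 a2' (admissibleT (ver A B)) no-wrap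
    up≡ : label (A , + 1 ℤ.+ B) ≡ label (A , B) + s
    up≡ = label-+-≤ (A , B) (A , + 1 ℤ.+ B) (val-up A B) no-wrap
    ascending : label (A , B) < label (A , + 1 ℤ.+ B)
    ascending = subst (label (A , B) <_) (sym up≡) (m<m+n _ (<-trans 0<r r<s))
  ver-endpoints A B (no wraps) =
      trans (cong tailQ folded)
            (trans (m∸n+[o+n∸m]≡o i s≤N (<⇒≤ N<i+s)) (sym (cong label (if-≮ᵇ descending))))
    , trans (cong headQ folded) (trans (sym up≡) (sym (cong label (if-≮ᵇ descending))))
    where
    i : ℕ
    i = label (A , B)
    N<i+s : N < i + s
    N<i+s = ≰⇒> wraps
    folded : fold (ver A B) ≡ a2' (i + s ∸ N) (m<n⇒0<n∸m N<i+s) (m≤n⇒m+o∸n≤o s (n%ℕd<d (val (A , B)) N))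
    folded = cyclicArrow-> a2 a2' (admissibleT (ver A B)) N<i+s refl
    up≡ : label (A , + 1 ℤ.+ B) ≡ i + s ∸ N
    up≡ = label-+-> (A , B) (A , + 1 ℤ.+ B) (val-up A B) s≤N N<i+s
    descending : label (A , + 1 ℤ.+ B) ≤ i
    descending = subst (_≤ i) (sym up≡) (m+n∸o≤m i s≤N)

  fold-endpoints : ∀ x → EndpointsAgree x
  fold-endpoints (hor A B) = hor-endpoints A B (label (A , B) + r ≤? N)
  fold-endpoints (ver A B) = ver-endpoints A B (label (A , B) + s ≤? N)
  fold-endpoints (diag₁ A B i+r+s≤N) =
      trans (+-comm r i) (sym (label-+-≤ (A , B) (+ 1 ℤ.+ A , B) (val-right A B) i+r≤N))
    , trans (+-comm s i) (sym (label-+-≤ (A , B) (A , + 1 ℤ.+ B) (val-up A B) i+s≤N))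
    where
    i : ℕ
    i = label (A , B)
    i+r≤N : i + r ≤ N
    i+r≤N = m+n≤o⇒m≤o (i + r) i+r+s≤N
    i+s≤N : i + s ≤ N
    i+s≤N = ≤-trans (+-monoˡ-≤ s (m≤m+n i r)) i+r+s≤N
  fold-endpoints (diag₂ A B (_ , N<i+s)) =
      trans r+[i+s∸N]≡i+[r+s]∸N
            (sym (label-+-> (A , B) (+ 1 ℤ.+ A , + 1 ℤ.+ B) (val-diagonal A B) r+s≤N N<i+[r+s]))
    , m∸n+[o+n∸m]≡o i s≤N (<⇒≤ N<i+s)
    where
    i : ℕ
    i = label (A , B)
    N<i+[r+s] : N < i + (r + s)
    N<i+[r+s] = <-≤-trans N<i+s (+-monoʳ-≤ i (m≤n+m s r))
    r+[i+s∸N]≡i+[r+s]∸N : r + (i + s ∸ N) ≡ i + (r + s) ∸ N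
    r+[i+s∸N]≡i+[r+s]∸N = trans (sym (+-∸-assoc r (<⇒≤ N<i+s))) (cong (_∸ N) (x∙yz≈y∙xz r i s))

  translate⇒sameOrbit : ∀ x x′ {δ} → kindT x ≡ kindT x′ → corner x′ ≡ corner x +ᵥ δ → InΛ N r s δ →
                        SameOrbit N r s x x′
  translate⇒sameOrbit (hor A B) (hor _ _) refl refl l = hor A B _ _ l
  translate⇒sameOrbit (ver A B) (ver _ _) refl refl l = ver A B _ _ l
  translate⇒sameOrbit (diag₁ A B p) (diag₁ _ _ q) refl refl l = diag₁ A B _ _ p q l
  translate⇒sameOrbit (diag₂ A B p) (diag₂ _ _ q) refl refl l = diag₂ A B _ _ p q l
  translate⇒sameOrbit (hor _ _) (ver _ _) ()
  translate⇒sameOrbit (hor _ _) (diag₁ _ _ _) ()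
  translate⇒sameOrbit (hor _ _) (diag₂ _ _ _) ()
  translate⇒sameOrbit (ver _ _) (hor _ _) ()
  translate⇒sameOrbit (ver _ _) (diag₁ _ _ _) ()
  translate⇒sameOrbit (ver _ _) (diag₂ _ _ _) ()
  translate⇒sameOrbit (diag₁ _ _ _) (hor _ _) ()
  translate⇒sameOrbit (diag₁ _ _ _) (ver _ _) ()
  translate⇒sameOrbit (diag₁ _ _ _) (diag₂ _ _ _) ()
  translate⇒sameOrbit (diag₂ _ _ _) (hor _ _) ()
  translate⇒sameOrbit (diag₂ _ _ _) (ver _ _) ()
  translate⇒sameOrbit (diag₂ _ _ _) (diag₁ _ _ _) ()

  fold-≡⇒sameOrbit : ∀ x x′ → fold x ≡ fold x′ → SameOrbit N r s x x′
  fold-≡⇒sameOrbit x x′ eq =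
    translate⇒sameOrbit x x′ kinds (sym (v+ᵥ[w−ᵥv]≡w (corner x) (corner x′)))
      (Equivalence.to (label-≡⇔InΛ (corner x′) (corner x)) (sym labels))
    where
    kinds : kindT x ≡ kindT x′
    kinds = trans (sym (kindQ-arrow _ _ (admissibleT x)))
                  (trans (cong kindQ eq) (kindQ-arrow _ _ (admissibleT x′)))
    labels : label (corner x) ≡ label (corner x′)
    labels = trans (sym (cornerLabel-arrow _ _ (admissibleT x)))
                   (trans (cong cornerLabel eq) (cornerLabel-arrow _ _ (admissibleT x′)))

  sameOrbit⇒fold-≡ : ∀ {x x′} → SameOrbit N r s x x′ → fold x ≡ fold x′
  sameOrbit⇒fold-≡ {x} {x′} (hor A B a b l) =
    arrow-cong hor (admissibleT x) (admissibleT x′) (label-+ᵥ-InΛ (A , B) (a , b) l)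
  sameOrbit⇒fold-≡ {x} {x′} (ver A B a b l) =
    arrow-cong ver (admissibleT x) (admissibleT x′) (label-+ᵥ-InΛ (A , B) (a , b) l)
  sameOrbit⇒fold-≡ {x} {x′} (diag₁ A B a b _ _ l) =
    arrow-cong diag₁ (admissibleT x) (admissibleT x′) (label-+ᵥ-InΛ (A , B) (a , b) l)
  sameOrbit⇒fold-≡ {x} {x′} (diag₂ A B a b _ _ l) =
    arrow-cong diag₂ (admissibleT x) (admissibleT x′) (label-+ᵥ-InΛ (A , B) (a , b) l)

  arrowAt : ∀ k v → Admissible k (label v) → TArr N r s
  arrowAt hor (A , B) _ = hor A B
  arrowAt ver (A , B) _ = ver A B
  arrowAt diag₁ (A , B) (_ , p) = diag₁ A B p
  arrowAt diag₂ (A , B) p = diag₂ A B p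

  fold-arrowAt : ∀ k v a → fold (arrowAt k v a) ≡ arrow k (label v) a
  fold-arrowAt hor v a = arrow-cong hor (admissibleT (arrowAt hor v a)) a refl
  fold-arrowAt ver v a = arrow-cong ver (admissibleT (arrowAt ver v a)) a refl
  fold-arrowAt diag₁ v a = arrow-cong diag₁ (admissibleT (arrowAt diag₁ v a)) a refl
  fold-arrowAt diag₂ v a = arrow-cong diag₂ (admissibleT (arrowAt diag₂ v a)) a refl

  fold-hits : ∀ y v → label v ≡ cornerLabel y → ∃ λ x → fold x ≡ y
  fold-hits y v label≡ = arrowAt (kindQ y) v a , (begin
    fold (arrowAt (kindQ y) v a)                     ≡⟨ fold-arrowAt (kindQ y) v a ⟩
    arrow (kindQ y) (label v) a                      ≡⟨ arrow-cong (kindQ y) a (admissibleQ y) label≡ ⟩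
    arrow (kindQ y) (cornerLabel y) (admissibleQ y)  ≡⟨ arrow-cornerLabel y ⟩
    y                                                ∎)
    where
    open ≡-Reasoning
    a : Admissible (kindQ y) (label v)
    a = subst (Admissible (kindQ y)) (sym label≡) (admissibleQ y)

  fold-surjective : gcd (gcd r s) N ≡ 1 → ∀ y → ∃ λ x → fold x ≡ y
  fold-surjective coprime y =
    uncurry (fold-hits y)
      (label-surjective (gcd₃≡1⇒Bézout-mod coprime) (Admissible⇒1≤i≤N (kindQ y) (admissibleQ y)))

proposition3p8 : (N r s : ℕ) .{{_ : NonZero N}} →
    0 < r → r < s → 2 * s ≤ N → gcd (gcd r s) N ≡ 1 →
    Σ (TArr N r s → QArr N r s) λ f →
      ((x : TArr N r s) →
        (tailQ (f x) ≡ lab N r s (tailT x)) × (headQ (f x) ≡ lab N r s (headT x)))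
      × ((y : QArr N r s) → ∃ λ x → f x ≡ y)
      × ((x x′ : TArr N r s) → (f x ≡ f x′) ⇔ SameOrbit N r s x x′)
proposition3p8 N r s 0<r r<s 2s≤N coprime =
  fold , fold-endpoints , fold-surjective coprime , λ x x′ → mk⇔ (fold-≡⇒sameOrbit x x′) sameOrbit⇒fold-≡
  where
  r+s≤N : r + s ≤ N
  r+s≤N = ≤-trans (+-monoˡ-≤ s (<⇒≤ r<s)) (subst (_≤ N) (cong (_+_ s) (+-identityʳ s)) 2s≤N)
  open Folding N r s 0<r r<s r+s≤N
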